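{- For every $n\ge 1$, the star $K_{1,n}$ (with $n+1$ vertices) satisfies $\sigma^-(K_{1,n})=\lceil n/2\rceil$.
   Context: For a simple graph $G$ with $N$ vertices and a bijection $f:V(G)\to\{1,\dots,N\}$, the parity signed graph $G_f$ is $G$ with each edge $uv$ given sign $+$ if $f(u),f(v)$ have the same parity and $-$ otherwise. The `rna' number $\sigma^-(G)$ is the minimum, over all such bijections $f$, of the number of negative edges of $G_f$. -}

module Defs where

open import Data.Nat using (ℕ; zero; suc; _+_; _≤_; _<_; _/_)
open import Data.Nat.Properties using (_<?_)
open import Data.Bool using (Bool; true; false; if_then_else_; _∧_; not; _xor_)
open import Data.Fin using (Fin; toℕ; zero; suc)
open import Data.List using (List; map; allFin; concatMap)
open import Data.Nat.ListAction using (sum)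
open import Data.Nat using (_%_; _≟_)
open import Data.Product using (Σ; _×_; _,_)
open import Function.Bundles using (_↔_; Inverse)
open import Relation.Binary.PropositionalEquality using (_≡_)
open import Relation.Nullary.Decidable using (⌊_⌋)

record Graph (N : ℕ) : Set where
  field
    adj   : Fin N → Fin N → Bool
    sym   : ∀ u v → adj u v ≡ adj v u
    irrefl : ∀ v → adj v v ≡ false
open Graph public

-- A labelling: bijection V(G) → {1,…,N}, encoded as a bijection Fin N ↔ Fin N
-- where vertex v receives the label toℕ (f v) + 1.
Labelling : ℕ → Set
Labelling N = Fin N ↔ Fin N

label : ∀ {N} → Labelling N → Fin N → ℕ
label f v = suc (toℕ (Inverse.to f v))

negativePair : ∀ {N} → Graph N → Labelling N → Fin N → Fin N → Bool
negativePair G f u v = adj G u v ∧ not ⌊ label f u % 2 ≟ label f v % 2 ⌋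

negEdges : ∀ {N} → Graph N → Labelling N → ℕ
negEdges {N} G f =
  sum (concatMap (λ u → map (λ v →
         if ⌊ toℕ u <? toℕ v ⌋ ∧ negativePair G f u v then 1 else 0)
       (allFin N)) (allFin N))

RnaNumber : ∀ {N} → Graph N → ℕ → Set
RnaNumber {N} G m =
  Σ (Labelling N) (λ f → negEdges G f ≡ m) × (∀ (f : Labelling N) → m ≤ negEdges G f)

starAdj : ∀ {n} → Fin (suc n) → Fin (suc n) → Bool
starAdj zero    zero    = false
starAdj zero    (suc _) = true
starAdj (suc _) zero    = true
starAdj (suc _) (suc _) = false

star : (n : ℕ) → Graph (suc n)
star n = record { adj = starAdj ; sym = s ; irrefl = i }
  where
    s : ∀ u v → starAdj u v ≡ starAdj v u
    s zero    zero    = _≡_.refl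
    s zero    (suc _) = _≡_.refl
    s (suc _) zero    = _≡_.refl
    s (suc _) (suc _) = _≡_.refl
    i : ∀ v → starAdj {n} v v ≡ false
    i zero    = _≡_.refl
    i (suc _) = _≡_.refl

ceilHalf : ℕ → ℕ
ceilHalf n = (n + 1) / 2

-- In a star every edge meets the centre, so the negative edges are the leaves whose
-- label has the other parity from the centre's label. Adding the centre itself (which never
-- disagrees with itself) and reindexing by the bijection, this is the number of labels in
-- {1, …, n+1} whose parity differs from that of the centre's label. Any two consecutive labels
-- contribute exactly one, so the count is at least ⌊(n+1)/2⌋ = ⌈n/2⌉, with equality when the
-- centre gets the odd label 1, as it does under the identity labelling.
module Submission where

open import Defs hiding (sym)
open import Data.Nat using (ℕ; zero; suc; _+_; _/_; _%_; _≟_; _≤_; z≤n; s≤s; parity)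
open import Data.Nat.Properties using (_<?_; +-comm; +-assoc; +-identityʳ; +-suc; +-0-commutativeMonoid)
open import Data.Nat.DivMod using (m/n≡1+[m∸n]/n)
open import Data.Nat.ListAction using () renaming (sum to sumList)
open import Data.Nat.ListAction.Properties using (sum-++)
open import Data.Parity.Base as ℙ using (Parity; 0ℙ; 1ℙ)
open import Data.Parity.Properties using (p+p≡0ℙ)
open import Data.Bool using (if_then_else_; _∧_; not)
open import Data.Bool.Properties using (∧-zeroʳ)
open import Data.Fin using (Fin; toℕ; zero; suc)
open import Data.List using (List; []; _∷_; map; allFin; concatMap; tabulate)
open import Data.List.Properties using (map-tabulate)
open import Data.Product using (_,_)
open import Function using (_∘_; id)
open import Function.Properties.Inverse using (↔-refl)
open import Relation.Binary.PropositionalEquality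
open import Relation.Nullary.Decidable using (⌊_⌋)
open import Algebra.Properties.CommutativeMonoid.Sum +-0-commutativeMonoid
  using (sum-syntax; sum-cong-≗; sum-replicate-zero; sum-permute)

open ≡-Reasoning

sumList-tabulate : ∀ {n} (g : Fin n → ℕ) → sumList (tabulate g) ≡ ∑[ i < n ] g i
sumList-tabulate {zero}  g = refl
sumList-tabulate {suc n} g = cong (g zero +_) (sumList-tabulate (g ∘ suc))

sumList-map-allFin : ∀ {n} (g : Fin n → ℕ) → sumList (map g (allFin n)) ≡ ∑[ i < n ] g i
sumList-map-allFin g = trans (cong sumList (map-tabulate id g)) (sumList-tabulate g)

sumList-concatMap : ∀ {A : Set} (F : A → List ℕ) (xs : List A) →
                    sumList (concatMap F xs) ≡ sumList (map (sumList ∘ F) xs)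
sumList-concatMap F []       = refl
sumList-concatMap F (x ∷ xs) =
  trans (sum-++ (F x) (concatMap F xs)) (cong (sumList (F x) +_) (sumList-concatMap F xs))

sum-zero : ∀ {n} (g : Fin n → ℕ) → (∀ i → g i ≡ 0) → ∑[ i < n ] g i ≡ 0
sum-zero {n} g g≡0 = trans (sum-cong-≗ g≡0) (sum-replicate-zero n)

bit : Parity → ℕ
bit 0ℙ = 0
bit 1ℙ = 1

n%2≡bit[parity] : ∀ n → n % 2 ≡ bit (parity n)
n%2≡bit[parity] zero          = refl
n%2≡bit[parity] (suc zero)    = refl
n%2≡bit[parity] (suc (suc n)) = n%2≡bit[parity] n

parityMismatch≡bit : ∀ a b → (if not ⌊ a % 2 ≟ b % 2 ⌋ then 1 else 0) ≡ bit (parity a ℙ.+ parity b)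
parityMismatch≡bit a b rewrite n%2≡bit[parity] a | n%2≡bit[parity] b with parity a | parity b
... | 0ℙ | 0ℙ = refl
... | 0ℙ | 1ℙ = refl
... | 1ℙ | 0ℙ = refl
... | 1ℙ | 1ℙ = refl

bit[p+parity]-consecutive : ∀ p k → bit (p ℙ.+ parity k) + bit (p ℙ.+ parity (suc k)) ≡ 1
bit[p+parity]-consecutive 0ℙ zero          = refl
bit[p+parity]-consecutive 1ℙ zero          = refl
bit[p+parity]-consecutive 0ℙ (suc zero)    = refl
bit[p+parity]-consecutive 1ℙ (suc zero)    = refl
bit[p+parity]-consecutive p  (suc (suc k)) = bit[p+parity]-consecutive p k

oppositeParityCount : Parity → ℕ → ℕ → ℕ
oppositeParityCount p k zero    = 0
oppositeParityCount p k (suc m) = bit (p ℙ.+ parity k) + oppositeParityCount p (suc k) m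

oppositeParityCount-shift2 : ∀ p k m → oppositeParityCount p (2 + k) m ≡ oppositeParityCount p k m
oppositeParityCount-shift2 p k zero    = refl
oppositeParityCount-shift2 p k (suc m) =
  cong (bit (p ℙ.+ parity k) +_) (oppositeParityCount-shift2 p (suc k) m)

oppositeParityCount-+2 : ∀ p k m → oppositeParityCount p k (2 + m) ≡ suc (oppositeParityCount p k m)
oppositeParityCount-+2 p k m = begin
  bit (p ℙ.+ parity k) + (bit (p ℙ.+ parity (suc k)) + oppositeParityCount p (2 + k) m)
    ≡⟨ +-assoc (bit (p ℙ.+ parity k)) _ _ ⟨
  (bit (p ℙ.+ parity k) + bit (p ℙ.+ parity (suc k))) + oppositeParityCount p (2 + k) m
    ≡⟨ cong₂ _+_ (bit[p+parity]-consecutive p k) (oppositeParityCount-shift2 p k m) ⟩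
  suc (oppositeParityCount p k m) ∎

[2+m]/2≡1+m/2 : ∀ m → (2 + m) / 2 ≡ suc (m / 2)
[2+m]/2≡1+m/2 m = m/n≡1+[m∸n]/n {2 + m} {2} (s≤s (s≤s z≤n))

half≤oppositeParityCount : ∀ p k m → m / 2 ≤ oppositeParityCount p k m
half≤oppositeParityCount p k zero          = z≤n
half≤oppositeParityCount p k (suc zero)    = z≤n
half≤oppositeParityCount p k (suc (suc m))
  rewrite [2+m]/2≡1+m/2 m | oppositeParityCount-+2 p k m = s≤s (half≤oppositeParityCount p k m)

oppositeParityCount-aligned : ∀ p k m → parity k ≡ p → oppositeParityCount p k m ≡ m / 2
oppositeParityCount-aligned p k zero          _  = refl
oppositeParityCount-aligned p k (suc zero)    refl =
  trans (+-identityʳ _) (cong bit (p+p≡0ℙ (parity k)))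
oppositeParityCount-aligned p k (suc (suc m)) aligned
  rewrite [2+m]/2≡1+m/2 m | oppositeParityCount-+2 p k m =
  cong suc (oppositeParityCount-aligned p k m aligned)

∑-oppositeParityCount : ∀ p k m →
                        ∑[ i < m ] bit (p ℙ.+ parity (k + toℕ i)) ≡ oppositeParityCount p k m
∑-oppositeParityCount p k zero    = refl
∑-oppositeParityCount p k (suc m) = cong₂ _+_
  (cong (λ j → bit (p ℙ.+ parity j)) (+-identityʳ k))
  (trans (sum-cong-≗ {m} (λ i → cong (λ j → bit (p ℙ.+ parity j)) (+-suc k (toℕ i))))
         (∑-oppositeParityCount p (suc k) m))

negEdgeIndicator : ∀ {N} → Graph N → Labelling N → Fin N → Fin N → ℕ
negEdgeIndicator G f u v = if ⌊ toℕ u <? toℕ v ⌋ ∧ negativePair G f u v then 1 else 0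

negEdges≡∑∑ : ∀ {N} (G : Graph N) (f : Labelling N) →
              negEdges G f ≡ ∑[ u < N ] ∑[ v < N ] negEdgeIndicator G f u v
negEdges≡∑∑ {N} G f = begin
  sumList (concatMap row (allFin N))         ≡⟨ sumList-concatMap row (allFin N) ⟩
  sumList (map (sumList ∘ row) (allFin N))   ≡⟨ sumList-map-allFin (sumList ∘ row) ⟩
  ∑[ u < N ] sumList (row u)
    ≡⟨ sum-cong-≗ (sumList-map-allFin ∘ negEdgeIndicator G f) ⟩
  ∑[ u < N ] ∑[ v < N ] negEdgeIndicator G f u v ∎
  where
  row : Fin N → List ℕ
  row u = map (negEdgeIndicator G f u) (allFin N)

∑-relabel : ∀ {N} (f : Labelling N) (g : ℕ → ℕ) →
            ∑[ v < N ] g (label f v) ≡ ∑[ i < N ] g (suc (toℕ i))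
∑-relabel f g = sym (sum-permute (g ∘ suc ∘ toℕ) f)

module _ (n : ℕ) (f : Labelling (suc n)) where

  centreParity : Parity
  centreParity = parity (label f zero)

  leafRow-negEdgeIndicator : ∀ w v → negEdgeIndicator (star n) f (suc w) v ≡ 0
  leafRow-negEdgeIndicator w zero    = refl
  leafRow-negEdgeIndicator w (suc v) rewrite ∧-zeroʳ ⌊ toℕ (suc w) <? toℕ (suc v) ⌋ = refl

  centreRow-negEdgeIndicator : ∀ v → negEdgeIndicator (star n) f zero v
                                     ≡ bit (centreParity ℙ.+ parity (label f v))
  centreRow-negEdgeIndicator zero    = cong bit (sym (p+p≡0ℙ centreParity))
  centreRow-negEdgeIndicator (suc w) = parityMismatch≡bit (label f zero) (label f (suc w))

  negEdges-star : negEdges (star n) f ≡ oppositeParityCount centreParity 1 (suc n)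
  negEdges-star = begin
    negEdges (star n) f
      ≡⟨ negEdges≡∑∑ (star n) f ⟩
    ∑[ v < suc n ] ind zero v + ∑[ w < n ] ∑[ v < suc n ] ind (suc w) v
      ≡⟨ cong (∑[ v < suc n ] ind zero v +_) leafRows≡0 ⟩
    ∑[ v < suc n ] ind zero v + 0
      ≡⟨ +-identityʳ _ ⟩
    ∑[ v < suc n ] ind zero v
      ≡⟨ sum-cong-≗ centreRow-negEdgeIndicator ⟩
    ∑[ v < suc n ] bit (centreParity ℙ.+ parity (label f v))
      ≡⟨ ∑-relabel f (λ j → bit (centreParity ℙ.+ parity j)) ⟩
    ∑[ i < suc n ] bit (centreParity ℙ.+ parity (1 + toℕ i))
      ≡⟨ ∑-oppositeParityCount centreParity 1 (suc n) ⟩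
    oppositeParityCount centreParity 1 (suc n) ∎
    where
    ind : Fin (suc n) → Fin (suc n) → ℕ
    ind = negEdgeIndicator (star n) f

    leafRows≡0 : ∑[ w < n ] ∑[ v < suc n ] ind (suc w) v ≡ 0
    leafRows≡0 = sum-zero {n} _ (λ w → sum-zero {suc n} _ (leafRow-negEdgeIndicator w))

ceilHalf≡[1+n]/2 : ∀ n → ceilHalf n ≡ suc n / 2
ceilHalf≡[1+n]/2 n = cong (_/ 2) (+-comm n 1)

mainTheorem8 : (n : ℕ) → 1 ≤ n → RnaNumber (star n) (ceilHalf n)
mainTheorem8 n _ rewrite ceilHalf≡[1+n]/2 n = (↔-refl , identity-attains) , half≤negEdges
  where
  identity-attains : negEdges (star n) ↔-refl ≡ suc n / 2
  identity-attains = trans (negEdges-star n ↔-refl) (oppositeParityCount-aligned 1ℙ 1 (suc n) refl)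

  half≤negEdges : ∀ f → suc n / 2 ≤ negEdges (star n) f
  half≤negEdges f =
    subst (suc n / 2 ≤_) (sym (negEdges-star n f)) (half≤oppositeParityCount _ 1 (suc n))
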